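{- There exists a set $A\subset\mathbb{N}$ such that $A$ is a basis of order $2$ (every sufficiently large positive integer is a sum of two elements of $A$), and for every partition $A=A_1\sqcup A_2$, at least one of the sumsets $A_1+A_1$ and $A_2+A_2$ does not have bounded gaps.
   Context: For a set $S$ of integers, $S+S=\{s+t: s,t\in S\}$. A set of integers has bounded gaps (is syndetic) if there is a constant $L$ such that every interval of $L$ consecutive positive integers contains an element of the set. -}

module Defs where

open import Level using (0ℓ)
open import Data.Nat using (ℕ; _+_; _≤_; _<_)
open import Data.Product using (Σ; ∃; _×_; _,_)
open import Data.Sum using (_⊎_)
open import Data.Empty using (⊥)
open import Relation.Binary.PropositionalEquality using (_≡_)

NatSet : Set₁
NatSet = ℕ → Set

SumSet : NatSet → NatSet
SumSet S n = ∃ λ s → ∃ λ t → S s × S t × s + t ≡ n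

IsBasisOfOrder2 : NatSet → Set
IsBasisOfOrder2 A = ∃ λ N → ∀ n → N ≤ n → SumSet A n

HasBoundedGaps : NatSet → Set
HasBoundedGaps S = ∃ λ L → ∀ m → 1 ≤ m → ∃ λ n → m ≤ n × n < m + L × S n

IsPartition : NatSet → NatSet → NatSet → Set
IsPartition A A₁ A₂ =
  (∀ n → A n → A₁ n ⊎ A₂ n) ×
  (∀ n → A₁ n → A n) ×
  (∀ n → A₂ n → A n) ×
  (∀ n → A₁ n → A₂ n → ⊥)

{-# OPTIONS --safe #-}
-- Take e₀ = 1, eₖ₊₁ = 5eₖ + 1 and A = {0} ∪ ⋃ₖ ([eₖ, 2eₖ] ∪ {3eₖ}). The blocks [eₖ, 5eₖ]
-- tile the positive integers, and each lies in A + A using the summands 0, eₖ, 2eₖ, 3eₖ.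
-- Every element of A up to 5eₖ other than 3eₖ is at most 2eₖ, so every representation of a
-- number in (4eₖ, 5eₖ] as a sum of two elements of A uses 3eₖ. If A₁ + A₁ and A₂ + A₂ both had
-- bounded gaps, then for eₖ beyond both gap lengths each would meet (4eₖ, 5eₖ], placing 3eₖ
-- in both parts.
module Submission where

open import Defs
open import Data.Product using (Σ; _×_; _,_; ∃)
open import Relation.Nullary using (¬_; yes; no)
open import Data.Nat using (ℕ; zero; suc; _+_; _*_; _∸_; _≤_; _<_; _≤′_; ≤′-refl; ≤′-step; z≤n; s≤s; _≟_; _≤?_)
open import Data.Nat.Properties
open import Data.Sum using (_⊎_; inj₁; inj₂)
open import Data.Empty using (⊥-elim)
open import Relation.Binary.Definitions using (tri<; tri≈; tri>)
open import Relation.Binary.PropositionalEquality using (_≡_; refl; sym; trans; subst)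

HasBoundedGaps⇒meets-long-intervals : ∀ {S : NatSet} → HasBoundedGaps S →
  ∃ λ L → ∀ a b → a + L ≤ b → ∃ λ n → a < n × n ≤ b × S n
HasBoundedGaps⇒meets-long-intervals (L , gaps) = L , λ a b a+L≤b →
  let (n , a<n , n<1+a+L , Sn) = gaps (suc a) (s≤s z≤n)
  in n , a<n , ≤-trans (≤-pred n<1+a+L) a+L≤b , Sn

forced-summand : ∀ {A B : NatSet} {a b x : ℕ} → (∀ n → B n → A n) →
  (∀ s t → A s → A t → a < s + t → s + t ≤ b → s ≡ x ⊎ t ≡ x) →
  (∃ λ n → a < n × n ≤ b × SumSet B n) → B x
forced-summand B⊆A uses-x (_ , a<n , n≤b , s , t , Bs , Bt , refl)
  with uses-x s t (B⊆A s Bs) (B⊆A t Bt) a<n n≤b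
... | inj₁ refl = Bs
... | inj₂ refl = Bt

interval-containing : (f : ℕ → ℕ) {n : ℕ} → f 0 ≤ n →
  ∀ k → n < f k → ∃ λ j → f j ≤ n × n < f (suc j)
interval-containing f f0≤n zero n<f0 = ⊥-elim (<⇒≱ n<f0 f0≤n)
interval-containing f {n} f0≤n (suc k) n<f[1+k] with f k ≤? n
... | yes fk≤n = k , fk≤n , n<f[1+k]
... | no fk≰n = interval-containing f f0≤n k (≰⇒> fk≰n)

split-multiples : ∀ m x n → x ≤ n → n ≤ (2 + m) * x →
  ∃ λ c → c ≤ m × (1 + c) * x ≤ n × n ≤ (2 + c) * x
split-multiples zero x n x≤n n≤2x = 0 , z≤n , subst (_≤ n) (sym (+-identityʳ x)) x≤n , n≤2x
split-multiples (suc m) x n x≤n n≤[3+m]x with n ≤? (2 + m) * x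
... | yes n≤[2+m]x =
  let (c , c≤m , lower , upper) = split-multiples m x n x≤n n≤[2+m]x
  in c , m≤n⇒m≤1+n c≤m , lower , upper
... | no n≰[2+m]x = suc m , ≤-refl , <⇒≤ (≰⇒> n≰[2+m]x) , n≤[3+m]x

e : ℕ → ℕ
e zero = 1
e (suc k) = suc (5 * e k)

Block : ℕ → NatSet
Block k x = (e k ≤ x × x ≤ 2 * e k) ⊎ x ≡ 3 * e k

A : NatSet
A x = x ≡ 0 ⊎ ∃ λ k → Block k x

e<e[1+k] : ∀ k → e k < e (suc k)
e<e[1+k] k = s≤s (m≤m+n (e k) (4 * e k))

e-mono′ : ∀ {j k} → j ≤′ k → e j ≤ e k
e-mono′ ≤′-refl = ≤-refl
e-mono′ (≤′-step j≤′k) = ≤-trans (e-mono′ j≤′k) (<⇒≤ (e<e[1+k] _))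

e-mono : ∀ {j k} → j ≤ k → e j ≤ e k
e-mono j≤k = e-mono′ (≤⇒≤′ j≤k)

n<e : ∀ n → n < e n
n<e zero = s≤s z≤n
n<e (suc n) = ≤-<-trans (n<e n) (e<e[1+k] n)

Block⇒e≤ : ∀ {k x} → Block k x → e k ≤ x
Block⇒e≤ (inj₁ (e≤x , _)) = e≤x
Block⇒e≤ {k} (inj₂ refl) = m≤m+n (e k) (2 * e k)

Block⇒<e[1+k] : ∀ {k x} → Block k x → x < e (suc k)
Block⇒<e[1+k] {k} block = s≤s (≤-trans (upper block) (*-monoˡ-≤ (e k) (m≤m+n 3 2)))
  where
  upper : ∀ {x} → Block k x → x ≤ 3 * e k
  upper (inj₁ (_ , x≤2e)) = ≤-trans x≤2e (*-monoˡ-≤ (e k) (n≤1+n 2))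
  upper (inj₂ refl) = ≤-refl

multiple-∈A : ∀ {c} k → c ≤ 3 → A (c * e k)
multiple-∈A k z≤n = inj₁ refl
multiple-∈A k (s≤s z≤n) =
  inj₂ (k , inj₁ (≤-reflexive (sym (+-identityʳ (e k))) , m≤n+m (1 * e k) (e k)))
multiple-∈A k (s≤s (s≤s z≤n)) = inj₂ (k , inj₁ (m≤m+n (e k) (1 * e k) , ≤-refl))
multiple-∈A k (s≤s (s≤s (s≤s z≤n))) = inj₂ (k , inj₂ refl)

shifted-block⊆A+A : ∀ {c n} k → c ≤ 3 → (1 + c) * e k ≤ n → n ≤ (2 + c) * e k → SumSet A n
shifted-block⊆A+A {c} {n} k c≤3 lower upper =
  c * e k , n ∸ c * e k , multiple-∈A k c≤3 ,
  inj₂ (k , inj₁ (m+n≤o⇒m≤o∸n (e k) lower , m≤n+o⇒m∸n≤o n (c * e k) upper′)) ,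
  m+[n∸m]≡n (m+n≤o⇒n≤o (e k) lower)
  where
  upper′ : n ≤ c * e k + 2 * e k
  upper′ = subst (n ≤_) (trans (*-distribʳ-+ (e k) 2 c) (+-comm (2 * e k) (c * e k))) upper

A-isBasisOfOrder2 : IsBasisOfOrder2 A
A-isBasisOfOrder2 = 1 , λ n 1≤n →
  let (k , e≤n , n<e[1+k]) = interval-containing e 1≤n n (n<e n)
      (c , c≤3 , lower , upper) = split-multiples 3 (e k) n e≤n (≤-pred n<e[1+k])
  in shifted-block⊆A+A k c≤3 lower upper

-- Elements of later blocks exceed 5eₖ, elements of earlier blocks are below eₖ.
A-below-top≤2e : ∀ k {x} → A x → x ≤ 5 * e k → ¬ x ≡ 3 * e k → x ≤ 2 * e k
A-below-top≤2e k (inj₁ refl) _ _ = z≤n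
A-below-top≤2e k (inj₂ (j , block)) x≤5e x≢3e with <-cmp j k
... | tri< j<k _ _ =
  ≤-trans (<⇒≤ (<-≤-trans (Block⇒<e[1+k] block) (e-mono j<k))) (m≤m+n (e k) (1 * e k))
... | tri≈ _ refl _ with block
...   | inj₁ (_ , x≤2e) = x≤2e
...   | inj₂ x≡3e = ⊥-elim (x≢3e x≡3e)
A-below-top≤2e k (inj₂ (j , block)) x≤5e x≢3e | tri> _ _ k<j =
  ⊥-elim (<⇒≱ (s≤s x≤5e) (≤-trans (e-mono k<j) (Block⇒e≤ block)))

top-window-sums-use-3e : ∀ k s t → A s → A t → 4 * e k < s + t → s + t ≤ 5 * e k →
  s ≡ 3 * e k ⊎ t ≡ 3 * e k
top-window-sums-use-3e k s t As At 4e<s+t s+t≤5e with s ≟ 3 * e k | t ≟ 3 * e k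
... | yes s≡3e | _ = inj₁ s≡3e
... | no _ | yes t≡3e = inj₂ t≡3e
... | no s≢3e | no t≢3e = ⊥-elim (<⇒≱ 4e<s+t s+t≤4e)
  where
  s+t≤4e : s + t ≤ 4 * e k
  s+t≤4e = subst (s + t ≤_) (sym (*-distribʳ-+ (e k) 2 2))
    (+-mono-≤ (A-below-top≤2e k As (≤-trans (m≤m+n s t) s+t≤5e) s≢3e)
              (A-below-top≤2e k At (≤-trans (m≤n+m t s) s+t≤5e) t≢3e))

bounded-gaps-meet-top-windows : ∀ {S : NatSet} → HasBoundedGaps S →
  ∃ λ K → ∀ k → K ≤ k → ∃ λ n → 4 * e k < n × n ≤ 5 * e k × S n
bounded-gaps-meet-top-windows gaps =
  let (L , meets) = HasBoundedGaps⇒meets-long-intervals gaps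
  in L , λ k L≤k →
       let L≤e = <⇒≤ (≤-<-trans L≤k (n<e k))
       in meets (4 * e k) (5 * e k) (subst (_≤ 5 * e k) (+-comm L (4 * e k)) (+-monoˡ-≤ (4 * e k) L≤e))

theorem3p1 : Σ NatSet λ A →
    IsBasisOfOrder2 A ×
    ((A₁ A₂ : NatSet) → IsPartition A A₁ A₂ →
      ¬ (HasBoundedGaps (SumSet A₁) × HasBoundedGaps (SumSet A₂)))
theorem3p1 = A , A-isBasisOfOrder2 , λ A₁ A₂ (_ , A₁⊆A , A₂⊆A , disjoint) (gaps₁ , gaps₂) →
  let (K₁ , meets₁) = bounded-gaps-meet-top-windows gaps₁
      (K₂ , meets₂) = bounded-gaps-meet-top-windows gaps₂
      k = K₁ + K₂
  in disjoint (3 * e k)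
       (forced-summand A₁⊆A (top-window-sums-use-3e k) (meets₁ k (m≤m+n K₁ K₂)))
       (forced-summand A₂⊆A (top-window-sums-use-3e k) (meets₂ k (m≤n+m K₂ K₁)))
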